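{- Let $G$ be a finite simple graph, and suppose that for every subgraph $H\subseteq G$ and every positive integer $t$, every nondegenerate $t$-matching on $H$ splits. Then $P_M(G)$ has the integer decomposition property.
   Context: For a graph $G$ with edge set $E$, $P_M(G)\subset\mathbb{R}^E$ is the convex hull of the indicator vectors of all matchings of $G$. For $t\in\mathbb{Z}_{\ge0}$, a $t$-matching on $G$ is a lattice point of $tP_M(G)$ (a $1$-matching is the indicator vector of a matching; the $0$-matching is the zero vector). A $t$-matching $x$ is nondegenerate if $x(e)>0$ for every edge $e$. A $t$-matching $x$ on $G$ ($t\ge1$) splits if $x=m+y$ for some matching $m$ on $G$ and some $(t-1)$-matching $y$ on $G$. A lattice polytope $P\subset\mathbb{R}^d$ has the integer decomposition property if for every $t\in\mathbb{Z}_{>0}$ and $\alpha\in tP\cap\mathbb{Z}^d$ there exist $\alpha_1,\dots,\alpha_t\in P\cap\mathbb{Z}^d$ with $\alpha=\sum\alpha_i$. -}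

module Defs where

open import Data.Nat using (ℕ; zero; suc)
open import Data.Integer as ℤ using (ℤ; +_)
open import Data.Rational as ℚ using (ℚ; 0ℚ; _/_)
open import Data.Fin using (Fin)
open import Data.Bool using (Bool; true; false)
open import Data.Product using (Σ; _×_; _,_; proj₁; proj₂; ∃-syntax)
open import Data.Sum using (_⊎_)
open import Data.List using (List; map; foldr)
open import Data.List.Relation.Unary.All using (All)
open import Data.Vec as Vec using (Vec)
import Data.Vec.Relation.Unary.All as VAll
open import Relation.Binary.PropositionalEquality using (_≡_; _≢_)
open import Relation.Nullary using (¬_)

record Graph : Set where
  field
    n    : ℕ
    m    : ℕ
    ends : Fin m → Fin n × Fin n
    loopless : ∀ e → proj₁ (ends e) ≢ proj₂ (ends e)
    simple   : ∀ e f →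
      (proj₁ (ends e) ≡ proj₁ (ends f) × proj₂ (ends e) ≡ proj₂ (ends f)) ⊎
      (proj₁ (ends e) ≡ proj₂ (ends f) × proj₂ (ends e) ≡ proj₁ (ends f)) →
      e ≡ f

open Graph public

_∈ₑ_ : {G : Graph} → Fin (n G) → Fin (m G) → Set
_∈ₑ_ {G} v e = v ≡ proj₁ (ends G e) ⊎ v ≡ proj₂ (ends G e)

record Subgraph (G : Graph) : Set where
  field
    vert : Fin (n G) → Bool
    edge : Fin (m G) → Bool
    closed : ∀ e → edge e ≡ true →
      vert (proj₁ (ends G e)) ≡ true × vert (proj₂ (ends G e)) ≡ true

open Subgraph public

whole : (G : Graph) → Subgraph G
whole G = record { vert = λ _ → true ; edge = λ _ → true ; closed = λ _ _ → _≡_.refl , _≡_.refl }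

IsMatching : {G : Graph} → Subgraph G → (Fin (m G) → Bool) → Set
IsMatching {G} H M =
  (∀ e → M e ≡ true → edge H e ≡ true) ×
  (∀ e f → e ≢ f → M e ≡ true → M f ≡ true →
     ∀ v → ¬ (_∈ₑ_ {G} v e × _∈ₑ_ {G} v f))

𝟙 : {k : ℕ} → (Fin k → Bool) → Fin k → ℤ
𝟙 M e with M e
... | true  = + 1
... | false = + 0

toℚ : ℤ → ℚ
toℚ z = z / 1

sumℚ : List ℚ → ℚ
sumℚ = foldr ℚ._+_ 0ℚ

-- x ∈ t·P_M(H): x is t times a convex combination of indicator vectors
-- of matchings of H, i.e. a nonnegative rational combination
-- Σ λᵢ 𝟙_{Mᵢ} with Σ λᵢ = t.  (Vectors on E(H) are represented as vectors
-- on E(G), extended by zero; points of t·P_M(H) vanish off E(H).)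
InDilate : {G : Graph} → Subgraph G → ℕ → (Fin (m G) → ℤ) → Set
InDilate {G} H t x =
  Σ (List (ℚ × (Fin (m G) → Bool))) λ L →
    All (λ p → (0ℚ ℚ.≤ proj₁ p) × IsMatching H (proj₂ p)) L ×
    sumℚ (map proj₁ L) ≡ toℚ (+ t) ×
    (∀ e → sumℚ (map (λ p → proj₁ p ℚ.* toℚ (𝟙 (proj₂ p) e)) L) ≡ toℚ (x e))

TMatching : {G : Graph} → Subgraph G → ℕ → (Fin (m G) → ℤ) → Set
TMatching = InDilate

Nondegenerate : {G : Graph} → Subgraph G → (Fin (m G) → ℤ) → Set
Nondegenerate {G} H x = ∀ e → edge H e ≡ true → + 0 ℤ.< x e

Splits : {G : Graph} → Subgraph G → ℕ → (Fin (m G) → ℤ) → Set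
Splits {G} H t x =
  Σ (Fin (m G) → Bool) λ M → Σ (Fin (m G) → ℤ) λ y →
    IsMatching H M × TMatching H (t Data.Nat.∸ 1) y ×
    (∀ e → x e ≡ 𝟙 M e ℤ.+ y e)

IDP-matching : Graph → Set
IDP-matching G =
  ∀ (t : ℕ) → 0 Data.Nat.< t → (α : Fin (m G) → ℤ) → InDilate (whole G) t α →
  Σ (Vec (Fin (m G) → ℤ) t) λ αs →
    VAll.All (InDilate (whole G) 1) αs ×
    (∀ e → α e ≡ Vec.foldr (λ _ → ℤ) (λ a r → a e ℤ.+ r) (+ 0) αs)

{-# OPTIONS --safe #-}
module Submission where

-- An integral α ∈ t·P_M(G) is a nonnegative combination of matchings, so α
-- vanishes wherever it is not positive, and every matching of the combination
-- can be cut down to the edges where α > 0 without changing the sum. Thus α is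
-- a nondegenerate t-matching of its support subgraph; by hypothesis
-- α = 𝟙_M + y with y a (t-1)-matching of that subgraph, hence of G, and
-- induction on t decomposes y.

open import Defs
open import Data.Nat using (ℕ; _<_; _∸_; zero; suc; s≤s; z≤n)
open import Data.Fin using (Fin)
open import Data.Integer as ℤ using (ℤ; +_; -[1+_])
import Data.Integer.Properties as ℤ
open import Data.Rational as ℚ using (ℚ; 0ℚ; 1ℚ)
import Data.Rational.Properties as ℚ
open import Data.Bool using (Bool; true; false; _∧_)
open import Data.Bool.Properties using (∧-conicalˡ; ∧-conicalʳ)
open import Data.Product using (Σ; _×_; _,_; proj₁; proj₂)
open import Data.List using (List; []; _∷_; map)
open import Data.List.Properties using (map-∘; map-cong)
open import Data.List.Relation.Unary.All as All using (All; []; _∷_)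
import Data.List.Relation.Unary.All.Properties as All
open import Data.Vec as Vec using (Vec; []; _∷_)
open import Data.Vec.Relation.Unary.All as VAll using ([]; _∷_)
open import Function using (_∘_; const)
open import Relation.Binary.PropositionalEquality
open import Relation.Nullary using (yes; no; ⌊_⌋; contradiction)

𝟙-cong : ∀ {k} (M N : Fin k → Bool) e → M e ≡ N e → 𝟙 M e ≡ 𝟙 N e
𝟙-cong M N e Me≡Ne with M e | N e
... | true  | true  = refl
... | false | false = refl

*-𝟙-nonNeg : ∀ {k} {l : ℚ} (M : Fin k → Bool) e → 0ℚ ℚ.≤ l → 0ℚ ℚ.≤ l ℚ.* toℚ (𝟙 M e)
*-𝟙-nonNeg {l = l} M e 0≤l with M e
... | true  = subst (0ℚ ℚ.≤_) (sym (ℚ.*-identityʳ l)) 0≤l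
... | false = subst (0ℚ ℚ.≤_) (sym (ℚ.*-zeroʳ l)) ℚ.≤-refl

sumℚ-nonNeg : ∀ {A : Set} (f : A → ℚ) {L} → All (λ a → 0ℚ ℚ.≤ f a) L → 0ℚ ℚ.≤ sumℚ (map f L)
sumℚ-nonNeg f []       = ℚ.≤-refl
sumℚ-nonNeg f (h ∷ hs) = ℚ.+-mono-≤ h (sumℚ-nonNeg f hs)

sumℚ-zeros : ∀ {A : Set} (L : List A) → sumℚ (map (const 0ℚ) L) ≡ 0ℚ
sumℚ-zeros []      = refl
sumℚ-zeros (_ ∷ L) = trans (cong (0ℚ ℚ.+_) (sumℚ-zeros L)) (ℚ.+-identityʳ 0ℚ)

toℚ-nonNeg∧≤0⇒≡0 : ∀ z → 0ℚ ℚ.≤ toℚ z → z ℤ.≤ + 0 → toℚ z ≡ 0ℚ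
toℚ-nonNeg∧≤0⇒≡0 (+ zero)   _   _ = refl
toℚ-nonNeg∧≤0⇒≡0 (+ suc n)  _   (ℤ.+≤+ ())
toℚ-nonNeg∧≤0⇒≡0 -[1+ n ]   0≤z _ =
  contradiction (ℚ.≤-<-trans 0≤z (ℚ.negative⁻¹ _ {{z<0}})) (ℚ.<-irrefl refl)
  where
  z<0 : ℚ.Negative (toℚ -[1+ n ])
  z<0 = ℚ.neg-pos {ℚ.normalize (suc n) 1} (ℚ.normalize-pos (suc n) 1)

isPositive : ℤ → Bool
isPositive z = ⌊ + 0 ℤ.<? z ⌋

isPositive-true : ∀ {z} → isPositive z ≡ true → + 0 ℤ.< z
isPositive-true {z} h with + 0 ℤ.<? z
... | yes 0<z = 0<z

isPositive-false : ∀ {z} → isPositive z ≡ false → z ℤ.≤ + 0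
isPositive-false {z} h with + 0 ℤ.<? z
... | no 0≮z = ℤ.≮⇒≥ 0≮z

module _ {G : Graph} where

  weighted : Fin (m G) → ℚ × (Fin (m G) → Bool) → ℚ
  weighted e p = proj₁ p ℚ.* toℚ (𝟙 (proj₂ p) e)

  isMatching-whole : ∀ (H : Subgraph G) {M} → IsMatching H M → IsMatching (whole G) M
  isMatching-whole _ (_ , disjoint) = (λ _ _ → refl) , disjoint

  inDilate-whole : ∀ (H : Subgraph G) {t x} → InDilate H t x → InDilate (whole G) t x
  inDilate-whole H (L , valid , total , coords) =
    L , All.map (λ {p} (0≤l , M-match) → 0≤l , isMatching-whole H {proj₂ p} M-match) valid ,
    total , coords

  isMatching⇒inDilate-1 : ∀ {H : Subgraph G} {M} → IsMatching H M → InDilate H 1 (𝟙 M)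
  isMatching⇒inDilate-1 M-match =
    (1ℚ , _) ∷ [] , (ℚ.nonNegative⁻¹ 1ℚ , M-match) ∷ [] , ℚ.+-identityʳ 1ℚ ,
    λ e → trans (ℚ.+-identityʳ _) (ℚ.*-identityˡ _)

  support : Subgraph G → (Fin (m G) → ℤ) → Subgraph G
  support H x = record
    { vert   = vert H
    ; edge   = λ e → isPositive (x e) ∧ edge H e
    ; closed = λ e h → closed H e (∧-conicalʳ _ _ h)
    }

  support-nondegenerate : ∀ (H : Subgraph G) (x : Fin (m G) → ℤ) → Nondegenerate (support H x) x
  support-nondegenerate H x e h = isPositive-true (∧-conicalˡ _ _ h)

  module _ (H : Subgraph G) (x : Fin (m G) → ℤ) where

    restrict : (Fin (m G) → Bool) → Fin (m G) → Bool
    restrict M e = isPositive (x e) ∧ M e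

    restrictTerm : ℚ × (Fin (m G) → Bool) → ℚ × (Fin (m G) → Bool)
    restrictTerm p = proj₁ p , restrict (proj₂ p)

    restrict-isMatching : ∀ {M} → IsMatching H M → IsMatching (support H x) (restrict M)
    restrict-isMatching (inH , disjoint) =
      (λ e h → cong₂ _∧_ (∧-conicalˡ _ _ h) (inH e (∧-conicalʳ _ _ h))) ,
      λ e f e≢f he hf → disjoint e f e≢f (∧-conicalʳ _ _ he) (∧-conicalʳ _ _ hf)

    weighted-restrictTerm : ∀ {b} e p → isPositive (x e) ≡ b →
      weighted e (restrictTerm p) ≡ proj₁ p ℚ.* toℚ (𝟙 (λ _ → b ∧ proj₂ p e) e)
    weighted-restrictTerm {b} e p pos = cong (λ z → proj₁ p ℚ.* toℚ z)
      (𝟙-cong (restrict (proj₂ p)) (λ _ → b ∧ proj₂ p e) e (cong (_∧ proj₂ p e) pos))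

    restrict-coordinate : ∀ {L} → All (λ p → 0ℚ ℚ.≤ proj₁ p) L → ∀ e →
      sumℚ (map (weighted e) L) ≡ toℚ (x e) →
      sumℚ (map (weighted e) (map restrictTerm L)) ≡ toℚ (x e)
    restrict-coordinate {L} weights-nonNeg e coord with isPositive (x e) in pos
    ... | true = begin
      sumℚ (map (weighted e) (map restrictTerm L))  ≡⟨ cong sumℚ (map-∘ L) ⟨
      sumℚ (map (weighted e ∘ restrictTerm) L)      ≡⟨ cong sumℚ (map-cong kept L) ⟩
      sumℚ (map (weighted e) L)                     ≡⟨ coord ⟩
      toℚ (x e)                                     ∎
      where
      open ≡-Reasoning
      kept : ∀ p → weighted e (restrictTerm p) ≡ weighted e p
      kept p = weighted-restrictTerm e p pos
    ... | false = begin
      sumℚ (map (weighted e) (map restrictTerm L))  ≡⟨ cong sumℚ (map-∘ L) ⟨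
      sumℚ (map (weighted e ∘ restrictTerm) L)      ≡⟨ cong sumℚ (map-cong dropped L) ⟩
      sumℚ (map (const 0ℚ) L)                       ≡⟨ sumℚ-zeros L ⟩
      0ℚ                                            ≡⟨ xe≡0 ⟨
      toℚ (x e)                                     ∎
      where
      open ≡-Reasoning
      dropped : ∀ p → weighted e (restrictTerm p) ≡ 0ℚ
      dropped p = trans (weighted-restrictTerm e p pos) (ℚ.*-zeroʳ (proj₁ p))
      xe≡0 : toℚ (x e) ≡ 0ℚ
      xe≡0 = toℚ-nonNeg∧≤0⇒≡0 (x e)
        (subst (0ℚ ℚ.≤_) coord
          (sumℚ-nonNeg (weighted e) (All.map (λ {p} → *-𝟙-nonNeg (proj₂ p) e) weights-nonNeg)))
        (isPositive-false pos)

    inDilate-support : ∀ {t} → InDilate H t x → InDilate (support H x) t x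
    inDilate-support (L , valid , total , coords) =
      map restrictTerm L ,
      All.map⁺ (All.map (λ (0≤l , M-match) → 0≤l , restrict-isMatching M-match) valid) ,
      trans (cong sumℚ (sym (map-∘ L))) total ,
      λ e → restrict-coordinate (All.map proj₁ valid) e (coords e)

NondegenerateSplitting : Graph → Set
NondegenerateSplitting G =
  (H : Subgraph G) (t : ℕ) → 0 < t → (x : Fin (m G) → ℤ) →
  TMatching H t x → Nondegenerate H x → Splits H t x

Decomposition : (G : Graph) → ℕ → (Fin (m G) → ℤ) → Set
Decomposition G t α =
  Σ (Vec (Fin (m G) → ℤ) t) λ αs →
    VAll.All (InDilate (whole G) 1) αs ×
    (∀ e → α e ≡ Vec.foldr (λ _ → ℤ) (λ a r → a e ℤ.+ r) (+ 0) αs)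

module _ {G : Graph} where

  tMatching-splits : NondegenerateSplitting G →
    ∀ t → 0 < t → ∀ α → TMatching (whole G) t α → Splits (whole G) t α
  tMatching-splits split t 0<t α α∈tP
    with split (support (whole G) α) t 0<t α
           (inDilate-support (whole G) α {t} α∈tP) (support-nondegenerate (whole G) α)
  ... | M , y , M-match , y∈P , α≡ =
    M , y , isMatching-whole (support (whole G) α) M-match ,
    inDilate-whole (support (whole G) α) {t ∸ 1} {y} y∈P , α≡

  decomposition-∷ : ∀ {t M α y} → IsMatching (whole G) M → (∀ e → α e ≡ 𝟙 M e ℤ.+ y e) →
    Decomposition G t y → Decomposition G (suc t) α
  decomposition-∷ {M = M} M-match α≡ (ys , ys∈P , y≡) =
    𝟙 M ∷ ys , isMatching⇒inDilate-1 {H = whole G} M-match ∷ ys∈P ,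
    λ e → trans (α≡ e) (cong (λ r → 𝟙 M e ℤ.+ r) (y≡ e))

  decompose : NondegenerateSplitting G →
    ∀ k α → InDilate (whole G) (suc k) α → Decomposition G (suc k) α
  decompose split zero α α∈P = α ∷ [] , α∈P ∷ [] , λ e → sym (ℤ.+-identityʳ (α e))
  decompose split (suc k) α α∈tP with tMatching-splits split (suc (suc k)) (s≤s z≤n) α α∈tP
  ... | M , y , M-match , y∈P , α≡ = decomposition-∷ M-match α≡ (decompose split k y y∈P)

lemma3p10 : (G : Graph) →
    ((H : Subgraph G) (t : ℕ) → 0 < t → (x : Fin (m G) → ℤ) →
      TMatching H t x → Nondegenerate H x → Splits H t x) →
    IDP-matching G
lemma3p10 G split (suc k) _ α α∈tP = decompose split k α α∈tP
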